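{- For all integers $d,r$ and $0\le m\le dr^2$, there are mappings $\varphi^x,\varphi^y:\{0,1,\dots,r\}^d\to\{0,1\}^{O(dr^2)^2}$ and an integer $0\le M\le O(dr^2)^2$ such that for all $x,y\in\{0,1,\dots,r\}^d$: if $\langle x,y\rangle=m$ then $\langle\varphi^x(x),\varphi^y(y)\rangle=M$; otherwise $\langle\varphi^x(x),\varphi^y(y)\rangle<M$. Moreover, $M$ depends only on $d$ and $r$. -}

module Defs where

open import Data.Nat using (ℕ; zero; suc; _+_; _*_)
open import Data.Bool using (Bool; true; false)
open import Data.Fin using (Fin; toℕ)
open import Data.Vec using (Vec; []; _∷_; map)

dotℕ : ∀ {n} → Vec ℕ n → Vec ℕ n → ℕ
dotℕ []       []       = 0
dotℕ (a ∷ as) (b ∷ bs) = a * b + dotℕ as bs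

Grid : ℕ → ℕ → Set
Grid d r = Vec (Fin (suc r)) d

dotGrid : ∀ {d r} → Grid d r → Grid d r → ℕ
dotGrid x y = dotℕ (map toℕ x) (map toℕ y)

bit : Bool → ℕ
bit true  = 1
bit false = 0

dotBool : ∀ {N} → Vec Bool N → Vec Bool N → ℕ
dotBool u v = dotℕ (map bit u) (map bit v)

{-# OPTIONS --safe #-}
-- Unary encoding turns ⟨x,y⟩ = s into an inner product ⟨u,v⟩ of 0/1 vectors of length L = d r².
-- Pairing 2m copies of u with v, the complement of u ⊗ u with that of v ⊗ v, and L² − m² ones with
-- ones, gives 2ms + (L² − s²) + (L² − m²) = 2L² − (s − m)², which attains its maximum 2L² exactly at s = m.
module Submission where

open import Defs
open import Data.Nat using (ℕ; zero; suc; _+_; _*_; _∸_; _^_; _≤_; _<_; ∣_-_∣)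
open import Data.Nat.Properties
open import Data.Nat.Tactic.RingSolver using (solve-∀)
open import Data.Bool using (Bool; true; false; not; _∧_)
open import Data.Fin using (Fin; toℕ)
open import Data.Vec using (Vec; []; _∷_; _++_; replicate; map; concat)
open import Function using (_∘_)
open import Data.Product using (Σ; _×_; _,_; ∃; ∃-syntax)
open import Relation.Binary.PropositionalEquality
  using (_≡_; _≢_; refl; sym; trans; cong; cong₂; subst; module ≡-Reasoning)

private variable
  k l n : ℕ

ones : (n : ℕ) → Vec Bool n
ones n = replicate n true

infixr 7 _⊗_

_⊗_ : Vec Bool k → Vec Bool l → Vec Bool (k * l)
u ⊗ w = concat (map (λ a → map (a ∧_) w) u)

dotBool-comm : (u v : Vec Bool n) → dotBool u v ≡ dotBool v u
dotBool-comm []      []      = refl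
dotBool-comm (a ∷ u) (b ∷ v) = cong₂ _+_ (*-comm (bit a) (bit b)) (dotBool-comm u v)

dotBool-ones : (n : ℕ) → dotBool (ones n) (ones n) ≡ n
dotBool-ones zero    = refl
dotBool-ones (suc n) = cong suc (dotBool-ones n)

dotBool-++ : (u : Vec Bool k) (u′ : Vec Bool l) (v : Vec Bool k) (v′ : Vec Bool l) →
             dotBool (u ++ u′) (v ++ v′) ≡ dotBool u v + dotBool u′ v′
dotBool-++ []      u′ []      v′ = refl
dotBool-++ (a ∷ u) u′ (b ∷ v) v′ =
  trans (cong (bit a * bit b +_) (dotBool-++ u u′ v v′)) (sym (+-assoc (bit a * bit b) _ _))

bit-∧ : ∀ a c → bit (a ∧ c) ≡ bit a * bit c
bit-∧ true  c = sym (+-identityʳ (bit c))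
bit-∧ false c = refl

dotBool-map-∧ : ∀ a b (w w′ : Vec Bool n) →
                dotBool (map (a ∧_) w) (map (b ∧_) w′) ≡ bit a * bit b * dotBool w w′
dotBool-map-∧ a b []      []        = sym (*-zeroʳ (bit a * bit b))
dotBool-map-∧ a b (c ∷ w) (e ∷ w′) = begin
  bit (a ∧ c) * bit (b ∧ e) + dotBool (map (a ∧_) w) (map (b ∧_) w′)
    ≡⟨ cong₂ _+_ (cong₂ _*_ (bit-∧ a c) (bit-∧ b e)) (dotBool-map-∧ a b w w′) ⟩
  bit a * bit c * (bit b * bit e) + bit a * bit b * dotBool w w′
    ≡⟨ interchange (bit a) (bit b) (bit c) (bit e) (dotBool w w′) ⟩
  bit a * bit b * (bit c * bit e + dotBool w w′) ∎
  where
  open ≡-Reasoning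
  interchange : ∀ x y z t s → x * z * (y * t) + x * y * s ≡ x * y * (z * t + s)
  interchange = solve-∀

dotBool-⊗ : (u v : Vec Bool k) (w w′ : Vec Bool l) →
            dotBool (u ⊗ w) (v ⊗ w′) ≡ dotBool u v * dotBool w w′
dotBool-⊗ []      []      w w′ = refl
dotBool-⊗ (a ∷ u) (b ∷ v) w w′ = begin
  dotBool (map (a ∧_) w ++ u ⊗ w) (map (b ∧_) w′ ++ v ⊗ w′)
    ≡⟨ dotBool-++ (map (a ∧_) w) (u ⊗ w) (map (b ∧_) w′) (v ⊗ w′) ⟩
  dotBool (map (a ∧_) w) (map (b ∧_) w′) + dotBool (u ⊗ w) (v ⊗ w′)
    ≡⟨ cong₂ _+_ (dotBool-map-∧ a b w w′) (dotBool-⊗ u v w w′) ⟩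
  bit a * bit b * dotBool w w′ + dotBool u v * dotBool w w′
    ≡⟨ *-distribʳ-+ (dotBool w w′) (bit a * bit b) (dotBool u v) ⟨
  (bit a * bit b + dotBool u v) * dotBool w w′ ∎
  where open ≡-Reasoning

complementˣ : Vec Bool n → Vec Bool (n * 2)
complementˣ u = concat (map (λ a → not a ∷ a ∷ []) u)

complementʸ : Vec Bool n → Vec Bool (n * 2)
complementʸ v = concat (map (λ b → true ∷ not b ∷ []) v)

-- Coordinatewise, (¬a)·1 + a·(¬b) = 1 − a·b.
dotBool-complement : (u v : Vec Bool n) → dotBool (complementˣ u) (complementʸ v) + dotBool u v ≡ n
dotBool-complement []          []          = refl
dotBool-complement (true ∷ u)  (true ∷ v)  = trans (+-suc _ _) (cong suc (dotBool-complement u v))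
dotBool-complement (true ∷ u)  (false ∷ v) = cong suc (dotBool-complement u v)
dotBool-complement (false ∷ u) (true ∷ v)  = cong suc (dotBool-complement u v)
dotBool-complement (false ∷ u) (false ∷ v) = cong suc (dotBool-complement u v)

unary : (r : ℕ) → Fin (suc r) → Vec Bool r
unary zero    _           = []
unary (suc r) Fin.zero    = false ∷ unary r Fin.zero
unary (suc r) (Fin.suc i) = true ∷ unary r i

dotBool-unary-ones : (r : ℕ) (i : Fin (suc r)) → dotBool (unary r i) (ones r) ≡ toℕ i
dotBool-unary-ones zero    Fin.zero    = refl
dotBool-unary-ones (suc r) Fin.zero    = dotBool-unary-ones r Fin.zero
dotBool-unary-ones (suc r) (Fin.suc i) = cong suc (dotBool-unary-ones r i)

encodeˣ : ∀ {d r} → Grid d r → Vec Bool (d * (r * r))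
encodeˣ {r = r} x = concat (map (λ i → unary r i ⊗ ones r) x)

encodeʸ : ∀ {d r} → Grid d r → Vec Bool (d * (r * r))
encodeʸ {r = r} y = concat (map (λ j → ones r ⊗ unary r j) y)

dotBool-encode : ∀ {d r} (x y : Grid d r) → dotBool (encodeˣ x) (encodeʸ y) ≡ dotGrid x y
dotBool-encode []                []      = refl
dotBool-encode {r = r} (i ∷ x) (j ∷ y) = begin
  dotBool (unary r i ⊗ ones r ++ encodeˣ x) (ones r ⊗ unary r j ++ encodeʸ y)
    ≡⟨ dotBool-++ (unary r i ⊗ ones r) (encodeˣ x) (ones r ⊗ unary r j) (encodeʸ y) ⟩
  dotBool (unary r i ⊗ ones r) (ones r ⊗ unary r j) + dotBool (encodeˣ x) (encodeʸ y)
    ≡⟨ cong₂ _+_ (dotBool-⊗ (unary r i) (ones r) (ones r) (unary r j)) (dotBool-encode x y) ⟩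
  dotBool (unary r i) (ones r) * dotBool (ones r) (unary r j) + dotGrid x y
    ≡⟨ cong (_+ dotGrid x y) (cong₂ _*_ (dotBool-unary-ones r i)
         (trans (dotBool-comm (ones r) (unary r j)) (dotBool-unary-ones r j))) ⟩
  toℕ i * toℕ j + dotGrid x y ∎
  where open ≡-Reasoning

∣m-n∣*∣m-n∣+2*[m*n]≡m*m+n*n : ∀ m n → ∣ m - n ∣ * ∣ m - n ∣ + 2 * (m * n) ≡ m * m + n * n
∣m-n∣*∣m-n∣+2*[m*n]≡m*m+n*n zero    n       = +-identityʳ (n * n)
∣m-n∣*∣m-n∣+2*[m*n]≡m*m+n*n (suc m) zero    =
  cong (λ z → suc m * suc m + 2 * z) (*-zeroʳ (suc m))
∣m-n∣*∣m-n∣+2*[m*n]≡m*m+n*n (suc m) (suc n) = begin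
  D * D + 2 * (suc m * suc n)          ≡⟨ shift-step D m n ⟩
  (D * D + 2 * (m * n)) + 2 * suc (m + n) ≡⟨ cong (_+ 2 * suc (m + n)) (∣m-n∣*∣m-n∣+2*[m*n]≡m*m+n*n m n) ⟩
  (m * m + n * n) + 2 * suc (m + n)    ≡⟨ unshift-step m n ⟩
  suc m * suc m + suc n * suc n        ∎
  where
  open ≡-Reasoning
  D = ∣ m - n ∣
  shift-step : ∀ t m n → t * t + 2 * (suc m * suc n) ≡ (t * t + 2 * (m * n)) + 2 * suc (m + n)
  shift-step = solve-∀
  unshift-step : ∀ m n → (m * m + n * n) + 2 * suc (m + n) ≡ suc m * suc m + suc n * suc n
  unshift-step = solve-∀

a+∣s-m∣*∣s-m∣≡M⇒[s≡m⇒a≡M]×[s≢m⇒a<M] : ∀ {a s m M} → a + ∣ s - m ∣ * ∣ s - m ∣ ≡ M →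
                                        (s ≡ m → a ≡ M) × (s ≢ m → a < M)
a+∣s-m∣*∣s-m∣≡M⇒[s≡m⇒a≡M]×[s≢m⇒a<M] {a} {s} {m} {M} eq = at-m , off-m
  where
  open ≡-Reasoning
  D = ∣ s - m ∣
  at-m : s ≡ m → a ≡ M
  at-m refl = begin
    a         ≡⟨ +-identityʳ a ⟨
    a + 0     ≡⟨ cong (λ t → a + t * t) (∣n-n∣≡0 s) ⟨
    a + D * D ≡⟨ eq ⟩
    M         ∎
  off-m : s ≢ m → a < M
  off-m s≢m = subst (a <_) eq (m<m+n a (*-mono-< 0<D 0<D))
    where 0<D = n≢0⇒n>0 (λ D≡0 → s≢m (∣m-n∣≡0⇒m≡n D≡0))

isolateˣ isolateʸ : (m : ℕ) → Vec Bool n → Vec Bool ((2 * m) * n + ((n * n) * 2 + (n * n ∸ m * m)))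
isolateˣ {n} m u = ones (2 * m) ⊗ u ++ complementˣ (u ⊗ u) ++ ones (n * n ∸ m * m)
isolateʸ {n} m v = ones (2 * m) ⊗ v ++ complementʸ (v ⊗ v) ++ ones (n * n ∸ m * m)

dotBool-isolate : ∀ {m} → m ≤ n → (u v : Vec Bool n) →
                  dotBool (isolateˣ m u) (isolateʸ m v) + ∣ dotBool u v - m ∣ * ∣ dotBool u v - m ∣
                  ≡ n * n + n * n
dotBool-isolate {n} {m} m≤n u v = begin
  dotBool (isolateˣ m u) (isolateʸ m v) + D * D
    ≡⟨ cong (_+ D * D) split ⟩
  ((2 * m) * s + (c + p)) + D * D
    ≡⟨ regroup m s c p (D * D) ⟩
  (c + p) + (D * D + 2 * (s * m))
    ≡⟨ cong ((c + p) +_) (∣m-n∣*∣m-n∣+2*[m*n]≡m*m+n*n s m) ⟩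
  (c + p) + (s * s + m * m)
    ≡⟨ interchange c p (s * s) (m * m) ⟩
  (c + s * s) + (p + m * m)
    ≡⟨ cong₂ _+_ c+s*s≡n*n (m∸n+n≡m (*-mono-≤ m≤n m≤n)) ⟩
  n * n + n * n ∎
  where
  open ≡-Reasoning
  s = dotBool u v
  D = ∣ s - m ∣
  p = n * n ∸ m * m
  c = dotBool (complementˣ (u ⊗ u)) (complementʸ (v ⊗ v))
  split : dotBool (isolateˣ m u) (isolateʸ m v) ≡ (2 * m) * s + (c + p)
  split = begin
    dotBool (isolateˣ m u) (isolateʸ m v)
      ≡⟨ dotBool-++ (ones (2 * m) ⊗ u) _ (ones (2 * m) ⊗ v) _ ⟩
    dotBool (ones (2 * m) ⊗ u) (ones (2 * m) ⊗ v)
      + dotBool (complementˣ (u ⊗ u) ++ ones p) (complementʸ (v ⊗ v) ++ ones p)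
      ≡⟨ cong₂ _+_ (dotBool-⊗ (ones (2 * m)) (ones (2 * m)) u v)
                   (dotBool-++ (complementˣ (u ⊗ u)) (ones p) (complementʸ (v ⊗ v)) (ones p)) ⟩
    dotBool (ones (2 * m)) (ones (2 * m)) * s + (c + dotBool (ones p) (ones p))
      ≡⟨ cong₂ (λ k l → k * s + (c + l)) (dotBool-ones (2 * m)) (dotBool-ones p) ⟩
    (2 * m) * s + (c + p) ∎
  c+s*s≡n*n : c + s * s ≡ n * n
  c+s*s≡n*n = trans (cong (c +_) (sym (dotBool-⊗ u v u v))) (dotBool-complement (u ⊗ u) (v ⊗ v))
  regroup : ∀ m s c p t → ((2 * m) * s + (c + p)) + t ≡ (c + p) + (t + 2 * (s * m))
  regroup = solve-∀
  interchange : ∀ c p q r → (c + p) + (q + r) ≡ (c + q) + (p + r)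
  interchange = solve-∀

n*n≡n^2 : ∀ n → n * n ≡ n ^ 2
n*n≡n^2 n = cong (n *_) (sym (*-identityʳ n))

isolate-length : ∀ {m} → m ≤ n → (2 * m) * n + ((n * n) * 2 + (n * n ∸ m * m)) ≤ 5 * n ^ 2
isolate-length {n} {m} m≤n = begin
  (2 * m) * n + ((n * n) * 2 + (n * n ∸ m * m))
    ≤⟨ +-mono-≤ (*-monoˡ-≤ n (*-monoʳ-≤ 2 m≤n)) (+-monoʳ-≤ ((n * n) * 2) (m∸n≤m (n * n) (m * m))) ⟩
  (2 * n) * n + ((n * n) * 2 + n * n)
    ≡⟨ collect n ⟩
  5 * (n * n)
    ≡⟨ cong (5 *_) (n*n≡n^2 n) ⟩
  5 * n ^ 2 ∎
  where
  open ≤-Reasoning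
  collect : ∀ n → (2 * n) * n + ((n * n) * 2 + n * n) ≡ 5 * (n * n)
  collect = solve-∀

n*n+n*n≤5*n^2 : ∀ n → n * n + n * n ≤ 5 * n ^ 2
n*n+n*n≤5*n^2 n = begin
  n * n + n * n               ≤⟨ m≤m+n (n * n + n * n) (3 * (n * n)) ⟩
  n * n + n * n + 3 * (n * n) ≡⟨ collect n ⟩
  5 * (n * n)                 ≡⟨ cong (5 *_) (n*n≡n^2 n) ⟩
  5 * n ^ 2                   ∎
  where
  open ≤-Reasoning
  collect : ∀ n → n * n + n * n + 3 * (n * n) ≡ 5 * (n * n)
  collect = solve-∀

IsolatesInnerProduct : (d r K B : ℕ) → Set
IsolatesInnerProduct d r K B = ∃[ M ] (M ≤ B
  × (∀ (m : ℕ) → m ≤ K → ∃[ N ] (N ≤ B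
    × Σ (Grid d r → Vec Bool N) λ φx → Σ (Grid d r → Vec Bool N) λ φy →
      ∀ (x y : Grid d r) →
        (dotGrid x y ≡ m → dotBool (φx x) (φy y) ≡ M)
        × (dotGrid x y ≢ m → dotBool (φx x) (φy y) < M))))

grid-isolation : ∀ d r → let L = d * (r * r) in IsolatesInnerProduct d r L (5 * L ^ 2)
grid-isolation d r = L * L + L * L , n*n+n*n≤5*n^2 L , λ m m≤L →
  _ , isolate-length m≤L , isolateˣ m ∘ encodeˣ , isolateʸ m ∘ encodeʸ ,
  λ x y → a+∣s-m∣*∣s-m∣≡M⇒[s≡m⇒a≡M]×[s≢m⇒a<M]
            (subst (λ s → dotBool (isolateˣ m (encodeˣ x)) (isolateʸ m (encodeʸ y))
                            + ∣ s - m ∣ * ∣ s - m ∣ ≡ L * L + L * L)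
                   (dotBool-encode x y)
                   (dotBool-isolate m≤L (encodeˣ x) (encodeʸ y)))
  where L = d * (r * r)

lemma6p3 : ∃[ C ] ∀ (d r : ℕ) → ∃[ M ] (M ≤ C * (d * r ^ 2) ^ 2
               × (∀ (m : ℕ) → m ≤ d * r ^ 2 → ∃[ N ] (N ≤ C * (d * r ^ 2) ^ 2
                 × Σ (Grid d r → Vec Bool N) λ φx → Σ (Grid d r → Vec Bool N) λ φy →
                   ∀ (x y : Grid d r) →
                     (dotGrid x y ≡ m → dotBool (φx x) (φy y) ≡ M)
                     × (dotGrid x y ≢ m → dotBool (φx x) (φy y) < M))))
lemma6p3 = 5 , λ d r →
  subst (λ K → IsolatesInnerProduct d r K (5 * K ^ 2))
        (cong (d *_) (n*n≡n^2 r))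
        (grid-isolation d r)
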